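{- For any integers $k\geq 2$ and $n\geq 1$ there is a pair of orthogoval $\mathrm{AG}(k,\mathbb{F}_{2^n})$.
   Context: $\mathrm{AG}(k,K)$ is the $k$-dimensional affine space over the field $K$; $\mathbb{F}_{2^n}$ is the finite field with $2^n$ elements. A pair of spaces, both projective or both affine, of the same dimension and order and on the same point set (two incidence structures on a common point set, each isomorphic to the given space) are orthogoval if each line of one space intersects each line of the other space in at most two points. -}

module Defs where

open import Level using (0ℓ)
open import Data.Nat using (ℕ)
open import Data.Fin using (Fin)
open import Data.Product using (Σ; ∃; ∃-syntax; _×_; _,_)
open import Relation.Nullary using (¬_)
open import Data.Empty using (⊥)
open import Relation.Binary.PropositionalEquality using (_≡_)
open import Relation.Binary.Bundles using (Setoid)
open import Algebra.Bundles using (CommutativeRing)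

_⇔_ : Set → Set → Set
A ⇔ B = (A → B) × (B → A)

record Field : Set₁ where
  field
    commRing : CommutativeRing 0ℓ 0ℓ
  open CommutativeRing commRing public
  field
    1≉0     : ¬ (1# ≈ 0#)
    inverse : ∀ x → ¬ (x ≈ 0#) → ∃[ y ] (x * y ≈ 1#)

record HasOrder (F : Field) (q : ℕ) : Set where
  open Field F
  field
    enum       : Fin q → Carrier
    enum-inj   : ∀ i j → enum i ≈ enum j → i ≡ j
    enum-surj  : ∀ x → ∃[ i ] (enum i ≈ x)

module AG (F : Field) (k : ℕ) where
  open Field F

  Point : Set
  Point = Fin k → Carrier

  _≈ᵖ_ : Point → Point → Set
  u ≈ᵖ v = ∀ i → u i ≈ v i

  0ᵖ : Point
  0ᵖ _ = 0#

  _+ᵖ_·_ : Point → Carrier → Point → Point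
  (p +ᵖ t · d) i = p i + t * d i

  lineSet : Point → Point → Point → Set
  lineSet p d x = ∃[ t ] (x ≈ᵖ (p +ᵖ t · d))

  IsAffineLine : (Point → Set) → Set
  IsAffineLine L = ∃[ p ] ∃[ d ] (¬ (d ≈ᵖ 0ᵖ) × (∀ x → L x ⇔ lineSet p d x))

record IncidenceStructure (P : Setoid 0ℓ 0ℓ) : Set₁ where
  open Setoid P
  field
    Line    : Set
    _on_    : Carrier → Line → Set
    on-resp : ∀ {x y ℓ} → x ≈ y → x on ℓ → y on ℓ

record IsoToAG {P : Setoid 0ℓ 0ℓ} (S : IncidenceStructure P) (F : Field) (k : ℕ) : Set where
  open Setoid P renaming (Carrier to Pt; _≈_ to _≈P_)
  open IncidenceStructure S
  open AG F k
  field
    φ       : Pt → Point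
    φ-cong  : ∀ x y → x ≈P y → φ x ≈ᵖ φ y
    φ-inj   : ∀ x y → φ x ≈ᵖ φ y → x ≈P y
    φ-surj  : ∀ v → ∃[ x ] (φ x ≈ᵖ v)
  image : Line → Point → Set
  image ℓ v = ∃[ x ] ((x on ℓ) × (φ x ≈ᵖ v))
  field
    line↦line   : ∀ ℓ → IsAffineLine (image ℓ)
    line-surj   : ∀ p d → ¬ (d ≈ᵖ 0ᵖ) → ∃[ ℓ ] (∀ v → image ℓ v ⇔ lineSet p d v)
    line-inj    : ∀ ℓ ℓ′ → (∀ v → image ℓ v ⇔ image ℓ′ v) → ℓ ≡ ℓ′

Orthogoval : {P : Setoid 0ℓ 0ℓ} → IncidenceStructure P → IncidenceStructure P → Set
Orthogoval {P} S T =
  ∀ (ℓ : IncidenceStructure.Line S) (m : IncidenceStructure.Line T) (x y z : Setoid.Carrier P) →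
    ¬ (Setoid._≈_ P x y) → ¬ (Setoid._≈_ P x z) → ¬ (Setoid._≈_ P y z) →
    IncidenceStructure._on_ S x ℓ → IncidenceStructure._on_ S y ℓ → IncidenceStructure._on_ S z ℓ →
    IncidenceStructure._on_ T x m → IncidenceStructure._on_ T y m → IncidenceStructure._on_ T z m →
    ⊥

{-# OPTIONS --safe #-}
module Submission where

-- Since |F| = 2^n is even, F has characteristic 2: otherwise negation would be an involution
-- of F fixing only 0. Take S = AG(k,F) and let T be its pull-back along π(x) = x + Q(x), where
--   Q(x) = (a(x_{k-1}² + x_0²), x_0², x_1², …, x_{k-2}²).
-- In characteristic 2, Q is additive with Q(tx) = t²Q(x), so π maps the line p + td onto the
-- parabola π(p) + td + t²Q(d). If three points of this parabola lie on a line, then d and Q(d)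
-- are both multiples of the direction of that line, so d is an eigenvector of Q. There are none.
-- For eigenvalue 0, all squares d_i² vanish. For eigenvalue c ≠ 0, e = d/c satisfies
-- e_{i+1} = e_i², hence a(e_0^{2^k} + e_0²) = e_0, and a is chosen so that this forces e_0 = 0:
-- the map y ↦ (y^{2^k} + y²)/y takes the value 0 at both 0 and 1, so on the finite field it
-- misses some w ≠ 0, and a = 1/w works. Having no fixed vector, π is injective, hence bijective,
-- so T is again an AG(k,F).

open import Defs
open import Level using (0ℓ)
open import Algebra.Bundles using (CommutativeRing)
open import Algebra.Definitions using (Involutive)
import Algebra.Properties.Semiring.Exp as Exp
import Algebra.Properties.Semiring.Mult as SemiringMultiplication
import Algebra.Solver.Ring.NaturalCoefficients as NaturalCoefficients
open import Data.Bool using (T; true)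
import Data.Bool as Bool
open import Data.Bool.Properties using (T-≡; T-irrelevant)
open import Data.Empty using (⊥-elim)
open import Data.Fin using (Fin; zero; suc; toℕ; fromℕ; inject₁; punchIn; punchOut; combine; remQuot)
open import Data.Fin.Induction using (<-weakInduction; >-weakInduction)
open import Data.Fin.Properties
  using (0≢1+n; suc-injective; toℕ-fromℕ; toℕ-inject₁; combine-remQuot; remQuot-combine; any?; all?; ¬∀⟶∃¬;
         injective⇒≤; punchIn-injective; punchInᵢ≢i; punchIn-punchOut; punchOut-injective)
  renaming (_≟_ to _≟ᶠ_)
open import Data.Fin.Subset using (Subset; _∈_)
open import Data.Fin.Subset.Properties using (⊆-antisym)
open import Data.Maybe using (Maybe; just; nothing)
import Data.Maybe as Maybe
open import Data.Nat using (ℕ; zero; suc)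
import Data.Nat as ℕ
open import Data.Nat.Divisibility using (_∣_; _∣0; m∣m*n; ∣-refl; ∣m∣n⇒∣m+n; ∣m+n∣m⇒∣n; ∣1⇒≡1)
import Data.Nat.Properties as ℕₚ
open import Data.Product using (Σ; ∃; ∃-syntax; _×_; _,_; proj₁; proj₂; uncurry)
open import Data.Product.Properties using (Σ-≡,≡→≡)
open import Data.Vec using (tabulate)
open import Data.Vec.Properties using (≡-dec; lookup∘tabulate; []=⇒lookup; lookup⇒[]=)
open import Data.Vec.Functional using (Vector; []; _∷_; head; tail)
open import Data.Vec.Functional.Relation.Binary.Equality.Setoid using (≋-setoid)
open import Function.Base using (_∘_; id)
open import Function.Bundles using (Inverse; Equivalence)
import Function.Consequences.Setoid as Consequences
open import Function.Definitions using (Congruent; Injective; StrictlyInverseˡ; StrictlyInverseʳ)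
open import Relation.Binary.Bundles using (Setoid)
open import Relation.Binary.Definitions using (Decidable; _Respects_)
open import Relation.Binary.PropositionalEquality as ≡ using (_≡_; _≢_; cong)
open import Relation.Nullary using (¬_; Dec; yes; no; contradiction)
open import Relation.Nullary.Decidable
  using (decidable-stable; map′; isYes; True; toWitness; fromWitness; ¬?; _×-dec_)

⇔-sym : ∀ {A B : Set} → A ⇔ B → B ⇔ A
⇔-sym (to , from) = from , to

⇔-trans : ∀ {A B C : Set} → A ⇔ B → B ⇔ C → A ⇔ C
⇔-trans (to , from) (to′ , from′) = to′ ∘ to , from ∘ from′

-- Involutions and endomaps of Fin n

module Restriction {m m′ : ℕ} (f : Fin m → Fin m) (f-involutive : Involutive _≡_ f)
         (e : Fin m′ → Fin m) (e-injective : Injective _≡_ _≡_ e)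
         (e-closed : ∀ i → ∃ λ j → e j ≡ f (e i)) where

  restrict : Fin m′ → Fin m′
  restrict i = proj₁ (e-closed i)

  restrict-involutive : Involutive _≡_ restrict
  restrict-involutive i = e-injective (≡.trans (proj₂ (e-closed _))
    (≡.trans (cong f (proj₂ (e-closed i))) (f-involutive (e i))))

  restrict-fixedPoint : ∀ i → restrict i ≡ i → f (e i) ≡ e i
  restrict-fixedPoint i fixed = ≡.trans (≡.sym (proj₂ (e-closed i))) (cong e fixed)

involutive⇒injective : ∀ {m} {f : Fin m → Fin m} → Involutive _≡_ f → Injective _≡_ _≡_ f
involutive⇒injective {f = f} f-involutive {i} {j} fi≡fj =
  ≡.trans (≡.sym (f-involutive i)) (≡.trans (cong f fi≡fj) (f-involutive j))

punchIn-onto : ∀ {m} (i j : Fin (suc m)) → i ≢ j → ∃ λ r → punchIn i r ≡ j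
punchIn-onto i j i≢j = punchOut i≢j , punchIn-punchOut i≢j

involution-fixedPointFree⇒even : ∀ {m} {f : Fin m → Fin m} →
  Involutive _≡_ f → (∀ i → f i ≢ i) → 2 ∣ m
involution-fixedPointFree⇒even {zero} _ _ = 2 ∣0
involution-fixedPointFree⇒even {suc zero} {f} _ free with f zero in f0
... | zero = ⊥-elim (free zero f0)
involution-fixedPointFree⇒even {suc (suc m)} {f} f-involutive free with f zero in f0
... | zero  = ⊥-elim (free zero f0)
... | suc j = ∣m∣n⇒∣m+n ∣-refl (involution-fixedPointFree⇒even {f = restrict} restrict-involutive
                (λ i fixed → free (e i) (restrict-fixedPoint i fixed)))
  where
  e : Fin m → Fin (suc (suc m))
  e i = suc (punchIn j i)
  e-injective : Injective _≡_ _≡_ e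
  e-injective p = punchIn-injective j _ _ (suc-injective p)
  f-injective : Injective _≡_ _≡_ f
  f-injective = involutive⇒injective {f = f} f-involutive
  f[1+j]≡0 : f (suc j) ≡ zero
  f[1+j]≡0 = ≡.trans (cong f (≡.sym f0)) (f-involutive zero)
  e-closed : ∀ i → ∃ λ r → e r ≡ f (e i)
  e-closed i with f (e i) in fe
  ... | zero  = ⊥-elim (punchInᵢ≢i j i (suc-injective (f-injective (≡.trans fe (≡.sym f[1+j]≡0)))))
  ... | suc y = let r , p = punchIn-onto j y j≢y in r , cong suc p
    where
    j≢y : j ≢ y
    j≢y ≡.refl = 0≢1+n (f-injective (≡.trans f0 (≡.sym fe)))
  open Restriction f f-involutive e e-injective e-closed

involution-uniqueFixedPoint⇒odd : ∀ {m} {f : Fin m → Fin m} → Involutive _≡_ f →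
  (a : Fin m) → f a ≡ a → (∀ i → f i ≡ i → i ≡ a) → ¬ 2 ∣ m
involution-uniqueFixedPoint⇒odd {suc m} {f} f-involutive a fa≡a unique 2∣1+m =
  contradiction (∣1⇒≡1 (∣m+n∣m⇒∣n (≡.subst (2 ∣_) (ℕₚ.+-comm 1 m) 2∣1+m) 2∣m)) λ ()
  where
  e-closed : ∀ i → ∃ λ r → punchIn a r ≡ f (punchIn a i)
  e-closed i = punchIn-onto a _ λ a≡f → punchInᵢ≢i a i
    (involutive⇒injective {f = f} f-involutive (≡.trans (≡.sym a≡f) (≡.sym fa≡a)))
  open Restriction f f-involutive (punchIn a) (punchIn-injective a _ _) e-closed
  2∣m : 2 ∣ m
  2∣m = involution-fixedPointFree⇒even {f = restrict} restrict-involutive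
    (λ i fixed → punchInᵢ≢i a i (unique _ (restrict-fixedPoint i fixed)))

Fin-injective⇒surjective : ∀ {n} {f : Fin n → Fin n} → Injective _≡_ _≡_ f → ∀ y → ∃ λ x → f x ≡ y
Fin-injective⇒surjective {f = f} f-injective y with any? (λ x → f x ≟ᶠ y)
... | yes hit = hit
Fin-injective⇒surjective {suc n} {f} f-injective y | no miss =
  contradiction (injective⇒≤ g-injective) ℕₚ.1+n≰n
  where
  g : Fin (suc n) → Fin n
  g x = punchOut {i = y} λ y≡fx → miss (x , ≡.sym y≡fx)
  g-injective : Injective _≡_ _≡_ g
  g-injective gx≡gx′ = f-injective (punchOut-injective {i = y} _ _ gx≡gx′)

Fin-surjective⇒injective : ∀ {n} {f : Fin n → Fin n} → (∀ y → ∃ λ x → f x ≡ y) → Injective _≡_ _≡_ f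
Fin-surjective⇒injective {n} {f} f-surjective {x} {x′} fx≡fx′ =
  ≡.trans (≡.sym (s∘f x)) (≡.trans (cong s fx≡fx′) (s∘f x′))
  where
  s : Fin n → Fin n
  s y = proj₁ (f-surjective y)
  f∘s : ∀ y → f (s y) ≡ y
  f∘s y = proj₂ (f-surjective y)
  s-injective : Injective _≡_ _≡_ s
  s-injective {y} {y′} sy≡sy′ = ≡.trans (≡.sym (f∘s y)) (≡.trans (cong f sy≡sy′) (f∘s y′))
  s∘f : ∀ x → s (f x) ≡ x
  s∘f x with y , ≡.refl ← Fin-injective⇒surjective s-injective x = cong s (f∘s y)

Fin-notInjective⇒notSurjective : ∀ {n} {f : Fin n → Fin n} {x x′} → f x ≡ f x′ → x ≢ x′ →
  ∃ λ y → ∀ z → f z ≢ y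
Fin-notInjective⇒notSurjective {n} {f} fx≡fx′ x≢x′ with all? (λ y → any? (λ z → f z ≟ᶠ y))
... | yes f-surjective = contradiction (Fin-surjective⇒injective f-surjective fx≡fx′) x≢x′
... | no ¬f-surjective =
  let y , miss = ¬∀⟶∃¬ n _ (λ y → any? (λ z → f z ≟ᶠ y)) ¬f-surjective in y , λ z fz≡y → miss (z , fz≡y)

-- Finite setoids

Enumeration : Setoid 0ℓ 0ℓ → ℕ → Set
Enumeration A n = Inverse (≡.setoid (Fin n)) A

mkEnumeration : ∀ {A : Setoid 0ℓ 0ℓ} {n} (enum : Fin n → Setoid.Carrier A) (index : Setoid.Carrier A → Fin n) →
  Congruent (Setoid._≈_ A) _≡_ index → StrictlyInverseˡ (Setoid._≈_ A) enum index → StrictlyInverseʳ _≡_ enum index →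
  Enumeration A n
mkEnumeration {A} {n} enum index index-cong enum-index index-enum = record
  { to        = enum
  ; from      = index
  ; to-cong   = reflexive ∘ cong enum
  ; from-cong = index-cong
  ; inverse   = strictlyInverseˡ⇒inverseˡ (reflexive ∘ cong enum) enum-index
              , strictlyInverseʳ⇒inverseʳ index-cong index-enum
  }
  where
  open Setoid A
  open Consequences (≡.setoid (Fin n)) A

module Enumerated {A : Setoid 0ℓ 0ℓ} {n : ℕ} (E : Enumeration A n) where
  open Setoid A
  open Inverse E public using ()
    renaming (to to enum; from to index; from-cong to index-cong;
              strictlyInverseˡ to enum-index; strictlyInverseʳ to index-enum)

  index-injective : Injective _≈_ _≡_ index
  index-injective {x} {y} ix≡iy =
    trans (sym (enum-index x)) (trans (reflexive (cong enum ix≡iy)) (enum-index y))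

  _≟_ : Decidable _≈_
  x ≟ y = map′ index-injective index-cong (index x ≟ᶠ index y)

  ∃? : ∀ {P : Carrier → Set} → P Respects _≈_ → (∀ x → Dec (P x)) → Dec (∃ P)
  ∃? P-resp P? = map′ (λ (i , p) → enum i , p) (λ (x , p) → index x , P-resp (sym (enum-index x)) p)
    (any? (P? ∘ enum))

  module _ {f : Carrier → Carrier} (f-cong : Congruent _≈_ _≈_ f) where

    private
      f̂ : Fin n → Fin n
      f̂ = index ∘ f ∘ enum

      f̂∘index : ∀ x → f̂ (index x) ≡ index (f x)
      f̂∘index x = index-cong (f-cong (enum-index x))

    injective⇒surjective : Injective _≈_ _≈_ f → ∀ y → ∃ λ x → f x ≈ y
    injective⇒surjective f-injective y =
      let i , f̂i≡iy = Fin-injective⇒surjective {f = f̂} f̂-injective (index y) in enum i , index-injective f̂i≡iy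
      where
      f̂-injective : Injective _≡_ _≡_ f̂
      f̂-injective f̂i≡f̂j = ≡.trans (≡.sym (index-enum _))
        (≡.trans (index-cong (f-injective (index-injective f̂i≡f̂j))) (index-enum _))

    notInjective⇒notSurjective : ∀ {x x′} → f x ≈ f x′ → ¬ x ≈ x′ → ∃ λ w → ∀ z → ¬ f z ≈ w
    notInjective⇒notSurjective {x} {x′} fx≈fx′ x≉x′ =
      let y , miss = Fin-notInjective⇒notSurjective {f = f̂} f̂x≡f̂x′ (x≉x′ ∘ index-injective)
      in enum y , λ z fz≈w → miss (index z) (≡.trans (f̂∘index z) (≡.trans (index-cong fz≈w) (index-enum y)))
      where
      f̂x≡f̂x′ : f̂ (index x) ≡ f̂ (index x′)
      f̂x≡f̂x′ = ≡.trans (f̂∘index x) (≡.trans (index-cong fx≈fx′) (≡.sym (f̂∘index x′)))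

  _∈ₛ_ : Carrier → Subset n → Set
  x ∈ₛ s = index x ∈ s

  ∈ₛ-resp : ∀ {s} → (_∈ₛ s) Respects _≈_
  ∈ₛ-resp {s} x≈y = ≡.subst (_∈ s) (index-cong x≈y)

  toSubset : ∀ {P : Carrier → Set} → (∀ x → Dec (P x)) → Subset n
  toSubset P? = tabulate (isYes ∘ P? ∘ enum)

  ∈-toSubset : ∀ {P : Carrier → Set} → P Respects _≈_ → (P? : ∀ x → Dec (P x)) →
    ∀ x → (x ∈ₛ toSubset P?) ⇔ P x
  ∈-toSubset P-resp P? x =
      (λ x∈ → P-resp (enum-index x) (toWitness (≡.subst T (≡.sym (isYes-at x∈)) _)))
    , (λ Px → lookup⇒[]= (index x) _ (≡.trans (lookup∘tabulate _ (index x))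
        (Equivalence.to T-≡ (fromWitness (P-resp (sym (enum-index x)) Px)))))
    where
    isYes-at : x ∈ₛ toSubset P? → isYes (P? (enum (index x))) ≡ true
    isYes-at x∈ = ≡.trans (≡.sym (lookup∘tabulate _ (index x))) ([]=⇒lookup x∈)

  subset-ext : ∀ {s t} → (∀ x → (x ∈ₛ s) ⇔ (x ∈ₛ t)) → s ≡ t
  subset-ext {s} {t} s⇔t = ⊆-antisym (λ {i} → via-enum i (proj₁ (s⇔t (enum i))))
                                     (λ {i} → via-enum i (proj₂ (s⇔t (enum i))))
    where
    via-enum : ∀ {u v} i → (enum i ∈ₛ u → enum i ∈ₛ v) → i ∈ u → i ∈ v
    via-enum {u} {v} i f i∈u =
      ≡.subst (_∈ v) (index-enum i) (f (≡.subst (_∈ u) (≡.sym (index-enum i)) i∈u))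

module _ {A : Setoid 0ℓ 0ℓ} {n : ℕ} (E : Enumeration A n) where
  open Setoid A
  open Enumerated E
  open import Data.Vec.Functional.Relation.Binary.Equality.Setoid A using (_≋_)

  private
    enumᵛ : ∀ k → Fin (n ℕ.^ k) → Vector Carrier k
    enumᵛ zero    _ = []
    enumᵛ (suc k) = uncurry (λ i c → enum i ∷ enumᵛ k c) ∘ remQuot (n ℕ.^ k)

    indexᵛ : ∀ k → Vector Carrier k → Fin (n ℕ.^ k)
    indexᵛ zero    _ = zero
    indexᵛ (suc k) v = combine (index (head v)) (indexᵛ k (tail v))

    indexᵛ-cong : ∀ k {v w : Vector Carrier k} → v ≋ w → indexᵛ k v ≡ indexᵛ k w
    indexᵛ-cong zero    _   = ≡.refl
    indexᵛ-cong (suc k) v≋w = ≡.cong₂ combine (index-cong (v≋w zero)) (indexᵛ-cong k (v≋w ∘ suc))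

    enumᵛ-indexᵛ : ∀ k v → enumᵛ k (indexᵛ k v) ≋ v
    enumᵛ-indexᵛ (suc k) v i = trans (reflexive (≡.cong-app split i)) (enum-index∷ i)
      where
      split : enumᵛ (suc k) (indexᵛ (suc k) v) ≡ enum (index (head v)) ∷ enumᵛ k (indexᵛ k (tail v))
      split = cong (uncurry (λ i c → enum i ∷ enumᵛ k c)) (remQuot-combine _ _)
      enum-index∷ : enum (index (head v)) ∷ enumᵛ k (indexᵛ k (tail v)) ≋ v
      enum-index∷ zero    = enum-index (head v)
      enum-index∷ (suc j) = enumᵛ-indexᵛ k (tail v) j

    indexᵛ-enumᵛ : ∀ k c → indexᵛ k (enumᵛ k c) ≡ c
    indexᵛ-enumᵛ zero    zero = ≡.refl
    indexᵛ-enumᵛ (suc k) c    =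
      ≡.trans (≡.cong₂ combine (index-enum _) (indexᵛ-enumᵛ k _)) (combine-remQuot {n} (n ℕ.^ k) c)

  vectorEnumeration : ∀ k → Enumeration (≋-setoid A k) (n ℕ.^ k)
  vectorEnumeration k = mkEnumeration (enumᵛ k) (indexᵛ k) (indexᵛ-cong k) (enumᵛ-indexᵛ k) (indexᵛ-enumᵛ k)

-- Characteristic 2 and finite fields

Characteristic2 : CommutativeRing 0ℓ 0ℓ → Set
Characteristic2 R = 1# + 1# ≈ 0#
  where open CommutativeRing R

module Characteristic2Properties (R : CommutativeRing 0ℓ 0ℓ) (1+1≈0 : Characteristic2 R) where
  open CommutativeRing R
  open SemiringMultiplication semiring using () renaming (_×_ to _×ᵣ_)
  open import Relation.Binary.Reasoning.Setoid setoid

  private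
    2+m×1≈m×1 : ∀ m → suc (suc m) ×ᵣ 1# ≈ m ×ᵣ 1#
    2+m×1≈m×1 m = begin
      1# + (1# + m ×ᵣ 1#) ≈⟨ +-assoc 1# 1# _ ⟨
      (1# + 1#) + m ×ᵣ 1# ≈⟨ +-congʳ 1+1≈0 ⟩
      0# + m ×ᵣ 1#        ≈⟨ +-identityˡ _ ⟩
      m ×ᵣ 1#             ∎

    sameParity? : ∀ m n → Maybe (m ×ᵣ 1# ≈ n ×ᵣ 1#)
    sameParity? (suc (suc m)) n             = Maybe.map (trans (2+m×1≈m×1 m)) (sameParity? m n)
    sameParity? m             (suc (suc n)) = Maybe.map (λ e → trans e (sym (2+m×1≈m×1 n))) (sameParity? m n)
    sameParity? zero          zero          = just refl
    sameParity? (suc zero)    (suc zero)    = just refl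
    sameParity? _             _             = nothing

  -- Coefficients are compared modulo 2, so the semiring solver proves the identities of characteristic 2.
  open NaturalCoefficients commutativeSemiring sameParity? public using (solve; _:+_; _:*_; _:^_; _:=_; con)

  x+x≈0 : ∀ x → x + x ≈ 0#
  x+x≈0 = solve 1 (λ x → x :+ x := con 0) refl

  x+y≈0⇒x≈y : ∀ {x y} → x + y ≈ 0# → x ≈ y
  x+y≈0⇒x≈y {x} {y} x+y≈0 = begin
    x            ≈⟨ solve 2 (λ x y → x := (x :+ y) :+ y) refl x y ⟩
    (x + y) + y  ≈⟨ +-congʳ x+y≈0 ⟩
    0# + y       ≈⟨ +-identityˡ y ⟩
    y            ∎

module IteratedSquares (R : CommutativeRing 0ℓ 0ℓ) where
  open CommutativeRing R hiding (zero)
  open Exp semiring using (_^_; ^-congˡ; ^-congʳ; ^-assocʳ)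
  open import Relation.Binary.Reasoning.Setoid setoid

  ^2^-suc : ∀ x n → (x ^ 2 ℕ.^ n) ^ 2 ≈ x ^ 2 ℕ.^ suc n
  ^2^-suc x n = trans (^-assocʳ x (2 ℕ.^ n) 2) (^-congʳ x (ℕₚ.*-comm (2 ℕ.^ n) 2))

  squaring-chain : ∀ {n} (e : Fin (suc n) → Carrier) → (∀ i → e (suc i) ≈ e (inject₁ i) ^ 2) →
    ∀ i → e i ≈ e zero ^ 2 ℕ.^ toℕ i
  squaring-chain e step =
    <-weakInduction (λ i → e i ≈ e zero ^ 2 ℕ.^ toℕ i) (sym (*-identityʳ _)) λ i chain-at-i → begin
    e (suc i)                              ≈⟨ step i ⟩
    e (inject₁ i) ^ 2                      ≈⟨ ^-congˡ 2 chain-at-i ⟩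
    (e zero ^ 2 ℕ.^ toℕ (inject₁ i)) ^ 2   ≈⟨ ^-congˡ 2 (^-congʳ _ (cong (2 ℕ.^_) (toℕ-inject₁ i))) ⟩
    (e zero ^ 2 ℕ.^ toℕ i) ^ 2             ≈⟨ ^2^-suc (e zero) (toℕ i) ⟩
    e zero ^ 2 ℕ.^ suc (toℕ i)             ∎

module DecidableField (F : Field) (_≟_ : Decidable (Field._≈_ F)) where
  open Field F
  open Exp semiring using (_^_)
  open import Relation.Binary.Reasoning.Setoid setoid

  infix 8 _⁻¹
  _⁻¹ : Carrier → Carrier
  x ⁻¹ with x ≟ 0#
  ... | yes _   = 0#
  ... | no x≉0 = proj₁ (inverse x x≉0)

  ⁻¹-zero : ∀ {x} → x ≈ 0# → x ⁻¹ ≈ 0#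
  ⁻¹-zero {x} x≈0 with x ≟ 0#
  ... | yes _   = refl
  ... | no x≉0 = contradiction x≈0 x≉0

  x*x⁻¹≈1 : ∀ {x} → ¬ x ≈ 0# → x * x ⁻¹ ≈ 1#
  x*x⁻¹≈1 {x} x≉0 with x ≟ 0#
  ... | yes x≈0 = contradiction x≈0 x≉0
  ... | no x≉0′ = proj₂ (inverse x x≉0′)

  x*y≈z⇒y≈x⁻¹*z : ∀ {x y z} → ¬ x ≈ 0# → x * y ≈ z → y ≈ x ⁻¹ * z
  x*y≈z⇒y≈x⁻¹*z {x} {y} {z} x≉0 x*y≈z = begin
    y                ≈⟨ *-identityˡ y ⟨
    1# * y           ≈⟨ *-congʳ (trans (*-comm _ _) (x*x⁻¹≈1 x≉0)) ⟨
    (x ⁻¹ * x) * y   ≈⟨ *-assoc _ _ _ ⟩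
    x ⁻¹ * (x * y)   ≈⟨ *-congˡ x*y≈z ⟩
    x ⁻¹ * z         ∎

  x*y≈0⇒y≈0 : ∀ {x y} → ¬ x ≈ 0# → x * y ≈ 0# → y ≈ 0#
  x*y≈0⇒y≈0 x≉0 x*y≈0 = trans (x*y≈z⇒y≈x⁻¹*z x≉0 x*y≈0) (zeroʳ _)

  x^2≈0⇒x≈0 : ∀ {x} → x ^ 2 ≈ 0# → x ≈ 0#
  x^2≈0⇒x≈0 {x} x^2≈0 = decidable-stable (x ≟ 0#) λ x≉0 →
    x≉0 (x*y≈0⇒y≈0 x≉0 (trans (*-congˡ (sym (*-identityʳ x))) x^2≈0))

  ⁻¹-cong : ∀ {x y} → x ≈ y → x ⁻¹ ≈ y ⁻¹
  ⁻¹-cong {x} {y} x≈y = by-cases (y ≟ 0#)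
    where
    by-cases : Dec (y ≈ 0#) → x ⁻¹ ≈ y ⁻¹
    by-cases (yes y≈0) = trans (⁻¹-zero (trans x≈y y≈0)) (sym (⁻¹-zero y≈0))
    by-cases (no y≉0)  =
      trans (x*y≈z⇒y≈x⁻¹*z y≉0 (trans (*-congʳ (sym x≈y)) (x*x⁻¹≈1 (y≉0 ∘ trans (sym x≈y))))) (*-identityʳ _)

orderEnumeration : ∀ {F : Field} {q} → HasOrder F q → Enumeration (Field.setoid F) q
orderEnumeration {F} {q} order = mkEnumeration enum index index-cong enum-index index-enum
  where
  open Field F
  open HasOrder order
  index : Carrier → Fin q
  index x = proj₁ (enum-surj x)
  enum-index : ∀ x → enum (index x) ≈ x
  enum-index x = proj₂ (enum-surj x)
  index-cong : ∀ {x y} → x ≈ y → index x ≡ index y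
  index-cong x≈y = enum-inj _ _ (trans (enum-index _) (trans x≈y (sym (enum-index _))))
  index-enum : ∀ i → index (enum i) ≡ i
  index-enum i = enum-inj _ _ (enum-index (enum i))

module FiniteField (F : Field) {q : ℕ} (order : HasOrder F q) where
  open Field F
  open Enumerated (orderEnumeration order) public
  open DecidableField F _≟_ public
  open import Algebra.Properties.Ring ring using (-0#≈0#; -‿involutive)
  open import Relation.Binary.Reasoning.Setoid setoid

  even-order⇒characteristic2 : 2 ∣ q → Characteristic2 commRing
  even-order⇒characteristic2 2∣q = decidable-stable ((1# + 1#) ≟ 0#) λ 1+1≉0 →
    involution-uniqueFixedPoint⇒odd {f = neg} neg-involutive (index 0#) neg-0 (neg-fixed⇒0 1+1≉0) 2∣q
    where
    neg : Fin q → Fin q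
    neg i = index (- enum i)
    neg-involutive : Involutive _≡_ neg
    neg-involutive i =
      ≡.trans (index-cong (trans (-‿cong (enum-index _)) (-‿involutive _))) (index-enum i)
    neg-0 : neg (index 0#) ≡ index 0#
    neg-0 = index-cong (trans (-‿cong (enum-index 0#)) -0#≈0#)
    neg-fixed⇒0 : ¬ (1# + 1#) ≈ 0# → ∀ i → neg i ≡ i → i ≡ index 0#
    neg-fixed⇒0 1+1≉0 i neg-fixed = ≡.trans (≡.sym (index-enum i)) (index-cong (x*y≈0⇒y≈0 1+1≉0 2x≈0))
      where
      x : Carrier
      x = enum i
      -x≈x : - x ≈ x
      -x≈x = index-injective (≡.trans neg-fixed (≡.sym (index-enum i)))
      2x≈0 : (1# + 1#) * x ≈ 0#
      2x≈0 = begin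
        (1# + 1#) * x   ≈⟨ distribʳ x 1# 1# ⟩
        1# * x + 1# * x ≈⟨ +-cong (*-identityˡ x) (*-identityˡ x) ⟩
        x + x           ≈⟨ +-congˡ -x≈x ⟨
        x + - x         ≈⟨ -‿inverseʳ x ⟩
        0#              ∎

-- Affine spaces over a finite field

Collinear : (F : Field) (k : ℕ) → AG.Point F k → AG.Point F k → AG.Point F k → Set
Collinear F k x y z = ∃[ p ] ∃[ d ] (¬ d ≈ᵖ 0ᵖ × lineSet p d x × lineSet p d y × lineSet p d z)
  where open AG F k

module AffineSpace (F : Field) {q : ℕ} (order : HasOrder F q) (k : ℕ) where
  open Field F
  open AG F k
  private
    module Scalars = FiniteField F order

  Points : Setoid 0ℓ 0ℓ
  Points = ≋-setoid setoid k

  pointEnumeration : Enumeration Points (q ℕ.^ k)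
  pointEnumeration = vectorEnumeration (orderEnumeration order) k

  open Enumerated pointEnumeration using (∃?; _∈ₛ_; ∈ₛ-resp; toSubset; ∈-toSubset; subset-ext)
    renaming (_≟_ to _≟ᵖ_)

  lineSet-resp : ∀ {p p′ d d′ x x′} → p ≈ᵖ p′ → d ≈ᵖ d′ → x ≈ᵖ x′ → lineSet p d x → lineSet p′ d′ x′
  lineSet-resp p≈p′ d≈d′ x≈x′ (t , x≈p+td) =
    t , λ i → trans (sym (x≈x′ i)) (trans (x≈p+td i) (+-cong (p≈p′ i) (*-congˡ (d≈d′ i))))

  lineSet? : ∀ p d x → Dec (lineSet p d x)
  lineSet? p d x = Scalars.∃? (λ t≈t′ x≈p+td i → trans (x≈p+td i) (+-congˡ (*-congʳ t≈t′)))
    (λ t → x ≟ᵖ (p +ᵖ t · d))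

  lineSubset : Point → Point → Subset (q ℕ.^ k)
  lineSubset p d = toSubset (lineSet? p d)

  ∈-lineSubset : ∀ p d x → (x ∈ₛ lineSubset p d) ⇔ lineSet p d x
  ∈-lineSubset p d = ∈-toSubset (lineSet-resp (λ _ → refl) (λ _ → refl)) (lineSet? p d)

  lineSubset-cong : ∀ {p p′ d d′} → p ≈ᵖ p′ → d ≈ᵖ d′ → lineSubset p d ≡ lineSubset p′ d′
  lineSubset-cong {p} {p′} {d} {d′} p≈p′ d≈d′ = subset-ext λ x →
      (proj₂ (∈-lineSubset p′ d′ x) ∘ lineSet-resp p≈p′ d≈d′ (λ _ → refl) ∘ proj₁ (∈-lineSubset p d x))
    , (proj₂ (∈-lineSubset p d x) ∘ lineSet-resp (sym ∘ p≈p′) (sym ∘ d≈d′) (λ _ → refl)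
                                 ∘ proj₁ (∈-lineSubset p′ d′ x))

  IsLine : Subset (q ℕ.^ k) → Set
  IsLine s = ∃[ p ] ∃[ d ] (¬ d ≈ᵖ 0ᵖ × s ≡ lineSubset p d)

  isLine? : ∀ s → Dec (IsLine s)
  isLine? s = ∃? (λ p≈p′ (d , d≉0 , s≡) → d , d≉0 , ≡.trans s≡ (lineSubset-cong p≈p′ (λ _ → refl)))
    λ p → ∃? (λ d≈d′ (d≉0 , s≡) → d≉0 ∘ (λ d′≈0 i → trans (d≈d′ i) (d′≈0 i))
                                  , ≡.trans s≡ (lineSubset-cong (λ _ → refl) d≈d′))
    λ d → ¬? (d ≟ᵖ 0ᵖ) ×-dec ≡-dec Bool._≟_ s (lineSubset p d)

  -- A line is coded by its characteristic vector, so that lines with the same points are equal.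
  Line : Set
  Line = Σ (Subset (q ℕ.^ k)) (True ∘ isLine?)

  _on_ : Point → Line → Set
  x on ℓ = x ∈ₛ proj₁ ℓ

  on-resp : ∀ {x y ℓ} → x ≈ᵖ y → x on ℓ → y on ℓ
  on-resp = ∈ₛ-resp

  line-points : ∀ ℓ → ∃[ p ] ∃[ d ] (¬ d ≈ᵖ 0ᵖ × (∀ x → (x on ℓ) ⇔ lineSet p d x))
  line-points (s , is-line) =
    let p , d , d≉0 , s≡ = toWitness {a? = isLine? s} is-line in
    p , d , d≉0 , λ x → ⇔-trans (≡.subst (x ∈ₛ_) s≡ , ≡.subst (x ∈ₛ_) (≡.sym s≡)) (∈-lineSubset p d x)

  lineThrough : ∀ p d → ¬ d ≈ᵖ 0ᵖ → ∃[ ℓ ] (∀ x → (x on ℓ) ⇔ lineSet p d x)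
  lineThrough p d d≉0 =
    (lineSubset p d , fromWitness {a? = isLine? (lineSubset p d)} (p , d , d≉0 , ≡.refl)) , ∈-lineSubset p d

  Line-ext : ∀ ℓ ℓ′ → (∀ x → (x on ℓ) ⇔ (x on ℓ′)) → ℓ ≡ ℓ′
  Line-ext ℓ ℓ′ same-points = Σ-≡,≡→≡ (subset-ext same-points , T-irrelevant _ _)

  module _ (ψ : Point → Point) (ψ-cong : ∀ {x y} → x ≈ᵖ y → ψ x ≈ᵖ ψ y) where

    pullback : IncidenceStructure Points
    pullback = record
      { Line    = Line
      ; _on_    = λ x ℓ → ψ x on ℓ
      ; on-resp = λ {_} {_} {ℓ} x≈y → on-resp {ℓ = ℓ} (ψ-cong x≈y)
      }

    pullback-isoToAG : (∀ x y → ψ x ≈ᵖ ψ y → x ≈ᵖ y) → (∀ v → ∃[ x ] (ψ x ≈ᵖ v)) → IsoToAG pullback F k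
    pullback-isoToAG ψ-injective ψ-surjective = record
      { φ          = ψ
      ; φ-cong     = λ _ _ → ψ-cong
      ; φ-inj      = ψ-injective
      ; φ-surj     = ψ-surjective
      ; line↦line  = λ ℓ → let p , d , d≉0 , on⇔ = line-points ℓ in
                       p , d , d≉0 , λ v → ⇔-trans (image⇔on ℓ v) (on⇔ v)
      ; line-surj  = λ p d d≉0 → let ℓ , on⇔ = lineThrough p d d≉0 in
                       ℓ , λ v → ⇔-trans (image⇔on ℓ v) (on⇔ v)
      ; line-inj   = λ ℓ ℓ′ same-image → Line-ext ℓ ℓ′ λ v →
                       ⇔-trans (⇔-sym (image⇔on ℓ v)) (⇔-trans (same-image v) (image⇔on ℓ′ v))
      }
      where
      image⇔on : ∀ ℓ v → (∃[ x ] ((ψ x on ℓ) × (ψ x ≈ᵖ v))) ⇔ (v on ℓ)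
      image⇔on ℓ v =
          (λ (x , ψx-on , ψx≈v) → on-resp {ℓ = ℓ} ψx≈v ψx-on)
        , (λ v-on → let x , ψx≈v = ψ-surjective v in x , on-resp {ℓ = ℓ} (sym ∘ ψx≈v) v-on , ψx≈v)

  on-line⇒collinear : ∀ ℓ {x y z} → x on ℓ → y on ℓ → z on ℓ → Collinear F k x y z
  on-line⇒collinear ℓ x-on y-on z-on =
    let p , d , d≉0 , on⇔ = line-points ℓ in
    p , d , d≉0 , proj₁ (on⇔ _) x-on , proj₁ (on⇔ _) y-on , proj₁ (on⇔ _) z-on

  pullbacks-orthogoval : (ψ : Point → Point) (ψ-cong : ∀ {x y} → x ≈ᵖ y → ψ x ≈ᵖ ψ y) →
    (∀ {x y z} → ¬ x ≈ᵖ y → ¬ x ≈ᵖ z → ¬ y ≈ᵖ z →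
       Collinear F k x y z → ¬ Collinear F k (ψ x) (ψ y) (ψ z)) →
    Orthogoval (pullback id id) (pullback ψ ψ-cong)
  pullbacks-orthogoval ψ ψ-cong breaks ℓ ℓ′ x y z x≉y x≉z y≉z x-on y-on z-on ψx-on ψy-on ψz-on =
    breaks x≉y x≉z y≉z (on-line⇒collinear ℓ x-on y-on z-on) (on-line⇒collinear ℓ′ ψx-on ψy-on ψz-on)

-- Frobenius-semilinear perturbations of the identity

module SemilinearMaps (F : Field) (_≟_ : Decidable (Field._≈_ F)) (char2 : Characteristic2 (Field.commRing F))
                      (k : ℕ) where
  open Field F
  open AG F k
  open DecidableField F _≟_
  open Characteristic2Properties commRing char2
  open Exp semiring using (_^_)
  open import Relation.Binary.Reasoning.Setoid setoid

  infixl 6 _+ᵛ_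
  infixr 7 _·ᵛ_
  infix 4 _∈⟨_⟩

  _+ᵛ_ : Point → Point → Point
  (u +ᵛ v) i = u i + v i

  _·ᵛ_ : Carrier → Point → Point
  (t ·ᵛ v) i = t * v i

  _∈⟨_⟩ : Point → Point → Set
  v ∈⟨ d ⟩ = ∃[ c ] (v ≈ᵖ (c ·ᵛ d))

  ∈⟨⟩-rebase : ∀ {u v w} → u ∈⟨ w ⟩ → v ∈⟨ w ⟩ → ¬ u ≈ᵖ 0ᵖ → v ∈⟨ u ⟩
  ∈⟨⟩-rebase {u} {v} {w} (δ , u≈δw) (γ , v≈γw) u≉0 = γ * δ ⁻¹ , λ i → begin
    v i               ≈⟨ v≈γw i ⟩
    γ * w i           ≈⟨ *-congˡ (x*y≈z⇒y≈x⁻¹*z δ≉0 (sym (u≈δw i))) ⟩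
    γ * (δ ⁻¹ * u i)  ≈⟨ *-assoc γ _ _ ⟨
    γ * δ ⁻¹ * u i    ∎
    where
    δ≉0 : ¬ δ ≈ 0#
    δ≉0 δ≈0 = u≉0 λ i → trans (u≈δw i) (trans (*-congʳ δ≈0) (zeroˡ _))

  secant : ∀ {A b c P d t t′ s s′} → ¬ t ≈ t′ →
    A + (t * b + t ^ 2 * c) ≈ P + s * d → A + (t′ * b + t′ ^ 2 * c) ≈ P + s′ * d →
    b + (t + t′) * c ≈ (t + t′) ⁻¹ * (s + s′) * d
  secant {A} {b} {c} {P} {d} {t} {t′} {s} {s′} t≉t′ at-t at-t′ =
    trans (x*y≈z⇒y≈x⁻¹*z (t≉t′ ∘ x+y≈0⇒x≈y) difference) (sym (*-assoc _ _ _))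
    where
    difference : (t + t′) * (b + (t + t′) * c) ≈ (s + s′) * d
    difference = begin
      (t + t′) * (b + (t + t′) * c)
        ≈⟨ solve 5 (λ A b c t t′ → (t :+ t′) :* (b :+ (t :+ t′) :* c)
                                := (A :+ (t :* b :+ t :^ 2 :* c)) :+ (A :+ (t′ :* b :+ t′ :^ 2 :* c)))
                 refl A b c t t′ ⟩
      (A + (t * b + t ^ 2 * c)) + (A + (t′ * b + t′ ^ 2 * c)) ≈⟨ +-cong at-t at-t′ ⟩
      (P + s * d) + (P + s′ * d)
        ≈⟨ solve 4 (λ P s s′ d → (P :+ s :* d) :+ (P :+ s′ :* d) := (s :+ s′) :* d) refl P s s′ d ⟩
      (s + s′) * d ∎

  parabola : Point → Point → Point → Carrier → Point
  parabola A b c t = A +ᵛ (t ·ᵛ b +ᵛ t ^ 2 ·ᵛ c)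

  parabola∩line : ∀ {A b c P d t₁ t₂ t₃ s₁ s₂ s₃} → ¬ t₁ ≈ t₂ → ¬ t₁ ≈ t₃ → ¬ t₂ ≈ t₃ →
    parabola A b c t₁ ≈ᵖ (P +ᵖ s₁ · d) → parabola A b c t₂ ≈ᵖ (P +ᵖ s₂ · d) →
    parabola A b c t₃ ≈ᵖ (P +ᵖ s₃ · d) →
    b ∈⟨ d ⟩ × c ∈⟨ d ⟩
  parabola∩line {A} {b} {c} {P} {d} {t₁} {t₂} {t₃} {s₁} {s₂} {s₃} t₁≉t₂ t₁≉t₃ t₂≉t₃ at-t₁ at-t₂ at-t₃ =
    (α + (t₁ + t₂) * γ , b≈) , (γ , c≈)
    where
    α β γ : Carrier
    α = (t₁ + t₂) ⁻¹ * (s₁ + s₂)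
    β = (t₁ + t₃) ⁻¹ * (s₁ + s₃)
    γ = (t₂ + t₃) ⁻¹ * (α + β)
    secant₁₂ : ∀ i → b i + (t₁ + t₂) * c i ≈ α * d i
    secant₁₂ i = secant t₁≉t₂ (at-t₁ i) (at-t₂ i)
    secant₁₃ : ∀ i → b i + (t₁ + t₃) * c i ≈ β * d i
    secant₁₃ i = secant t₁≉t₃ (at-t₁ i) (at-t₃ i)
    c≈ : c ≈ᵖ (γ ·ᵛ d)
    c≈ i = trans (x*y≈z⇒y≈x⁻¹*z (t₂≉t₃ ∘ x+y≈0⇒x≈y) second-difference) (sym (*-assoc _ _ _))
      where
      second-difference : (t₂ + t₃) * c i ≈ (α + β) * d i
      second-difference = begin
        (t₂ + t₃) * c i
          ≈⟨ solve 5 (λ b c t₁ t₂ t₃ → (t₂ :+ t₃) :* c := (b :+ (t₁ :+ t₂) :* c) :+ (b :+ (t₁ :+ t₃) :* c))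
                   refl (b i) (c i) t₁ t₂ t₃ ⟩
        (b i + (t₁ + t₂) * c i) + (b i + (t₁ + t₃) * c i) ≈⟨ +-cong (secant₁₂ i) (secant₁₃ i) ⟩
        α * d i + β * d i                                 ≈⟨ distribʳ (d i) α β ⟨
        (α + β) * d i                                     ∎
    b≈ : b ≈ᵖ ((α + (t₁ + t₂) * γ) ·ᵛ d)
    b≈ i = begin
      b i                                       ≈⟨ solve 3 (λ b c u → b := (b :+ u :* c) :+ u :* c)
                                                            refl (b i) (c i) (t₁ + t₂) ⟩
      (b i + (t₁ + t₂) * c i) + (t₁ + t₂) * c i ≈⟨ +-cong (secant₁₂ i) (*-congˡ (c≈ i)) ⟩
      α * d i + (t₁ + t₂) * (γ * d i)           ≈⟨ solve 4 (λ α u γ d → α :* d :+ u :* (γ :* d) := (α :+ u :* γ) :* d)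
                                                            refl α (t₁ + t₂) γ (d i) ⟩
      (α + (t₁ + t₂) * γ) * d i                 ∎

  record IsFrobeniusSemilinear (Q : Point → Point) : Set where
    field
      congruent   : ∀ {x y} → x ≈ᵖ y → Q x ≈ᵖ Q y
      additive    : ∀ x y → Q (x +ᵛ y) ≈ᵖ (Q x +ᵛ Q y)
      homogeneous : ∀ t x → Q (t ·ᵛ x) ≈ᵖ (t ^ 2 ·ᵛ Q x)

  HasNoEigenvector : (Point → Point) → Set
  HasNoEigenvector Q = ∀ d → Q d ∈⟨ d ⟩ → d ≈ᵖ 0ᵖ

  module Perturbation {Q : Point → Point} (Q-semilinear : IsFrobeniusSemilinear Q)
                      (no-eigenvector : HasNoEigenvector Q) where
    open IsFrobeniusSemilinear Q-semilinear

    π : Point → Point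
    π x = x +ᵛ Q x

    π-cong : ∀ {x y} → x ≈ᵖ y → π x ≈ᵖ π y
    π-cong x≈y i = +-cong (x≈y i) (congruent x≈y i)

    π-injective : ∀ x y → π x ≈ᵖ π y → x ≈ᵖ y
    π-injective x y πx≈πy i = x+y≈0⇒x≈y (x+y≈0 i)
      where
      x+y≈0 : (x +ᵛ y) ≈ᵖ 0ᵖ
      x+y≈0 = no-eigenvector (x +ᵛ y) (1# , λ j → begin
        Q (x +ᵛ y) j                  ≈⟨ additive x y j ⟩
        Q x j + Q y j                 ≈⟨ solve 4 (λ x y u v → u :+ v := (x :+ y) :+ ((x :+ u) :+ (y :+ v)))
                                                 refl (x j) (y j) (Q x j) (Q y j) ⟩
        (x j + y j) + (π x j + π y j) ≈⟨ +-congˡ (trans (+-congʳ (πx≈πy j)) (x+x≈0 (π y j))) ⟩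
        (x j + y j) + 0#              ≈⟨ +-identityʳ _ ⟩
        x j + y j                     ≈⟨ *-identityˡ _ ⟨
        1# * (x j + y j)              ∎)

    π-line : ∀ p t d → π (p +ᵖ t · d) ≈ᵖ parabola (π p) d (Q d) t
    π-line p t d i = begin
      (p i + t * d i) + Q (p +ᵖ t · d) i
        ≈⟨ +-congˡ (trans (additive p (t ·ᵛ d) i) (+-congˡ (homogeneous t d i))) ⟩
      (p i + t * d i) + (Q p i + t ^ 2 * Q d i)
        ≈⟨ solve 4 (λ p u v w → (p :+ u) :+ (v :+ w) := (p :+ v) :+ (u :+ w))
                 refl (p i) (t * d i) (Q p i) (t ^ 2 * Q d i) ⟩
      (p i + Q p i) + (t * d i + t ^ 2 * Q d i) ∎

    π-breaksCollinearity : ∀ {x y z} → ¬ x ≈ᵖ y → ¬ x ≈ᵖ z → ¬ y ≈ᵖ z →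
      Collinear F k x y z → ¬ Collinear F k (π x) (π y) (π z)
    π-breaksCollinearity x≉y x≉z y≉z (p , d , d≉0 , (_ , x≈) , (_ , y≈) , (_ , z≈))
                                     (p′ , d′ , _ , (_ , πx≈) , (_ , πy≈) , (_ , πz≈)) =
      let d∈⟨d′⟩ , Qd∈⟨d′⟩ = parabola∩line
            (parameters-distinct x≈ y≈ x≉y) (parameters-distinct x≈ z≈ x≉z) (parameters-distinct y≈ z≈ y≉z)
            (on-parabola x≈ πx≈) (on-parabola y≈ πy≈) (on-parabola z≈ πz≈)
      in d≉0 (no-eigenvector d (∈⟨⟩-rebase d∈⟨d′⟩ Qd∈⟨d′⟩ d≉0))
      where
      on-parabola : ∀ {u t s} → u ≈ᵖ (p +ᵖ t · d) → π u ≈ᵖ (p′ +ᵖ s · d′) →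
        parabola (π p) d (Q d) t ≈ᵖ (p′ +ᵖ s · d′)
      on-parabola {t = t} u≈ πu≈ i = trans (sym (π-line p t d i)) (trans (π-cong (λ j → sym (u≈ j)) i) (πu≈ i))
      parameters-distinct : ∀ {u v tu tv} → u ≈ᵖ (p +ᵖ tu · d) → v ≈ᵖ (p +ᵖ tv · d) → ¬ u ≈ᵖ v → ¬ tu ≈ tv
      parameters-distinct u≈ v≈ u≉v tu≈tv =
        u≉v λ i → trans (u≈ i) (trans (+-congˡ (*-congʳ tu≈tv)) (sym (v≈ i)))

-- The twisted Frobenius shift

-- If d is an eigenvector of the map Q of TwistedFrobeniusShift for an eigenvalue c ≉ 0,
-- then y = d₀ / c solves this equation.
Admissible : (F : Field) → ℕ → Field.Carrier F → Set
Admissible F k a = ∀ y → a * (y ^ 2 ℕ.^ k + y ^ 2) ≈ y → y ≈ 0#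
  where
  open Field F
  open Exp semiring using (_^_)

module _ (F : Field) {q : ℕ} (order : HasOrder F q) (char2 : Characteristic2 (Field.commRing F)) where
  open Field F hiding (zero)
  open FiniteField F order
  open Exp semiring using (_^_; ^-congˡ)
  open import Relation.Binary.Reasoning.Setoid setoid

  admissible-exists : ∀ k → ∃[ a ] (¬ a ≈ 0# × Admissible F k a)
  admissible-exists k = w ⁻¹ , w⁻¹≉0 , admissible
    where
    -- g 0# ≈ 0# by the junk value 0# ⁻¹ = 0#.
    g : Carrier → Carrier
    g y = (y ^ 2 ℕ.^ k + y ^ 2) * y ⁻¹
    g-cong : ∀ {y y′} → y ≈ y′ → g y ≈ g y′
    g-cong y≈y′ = *-cong (+-cong (^-congˡ (2 ℕ.^ k) y≈y′) (^-congˡ 2 y≈y′)) (⁻¹-cong y≈y′)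
    1^n≈1 : ∀ n → 1# ^ n ≈ 1#
    1^n≈1 zero    = refl
    1^n≈1 (suc n) = trans (*-identityˡ _) (1^n≈1 n)
    g0≈0 : g 0# ≈ 0#
    g0≈0 = trans (*-congˡ (⁻¹-zero refl)) (zeroʳ _)
    g1≈0 : g 1# ≈ 0#
    g1≈0 = trans (*-congʳ (trans (+-cong (1^n≈1 (2 ℕ.^ k)) (1^n≈1 2)) char2)) (zeroˡ _)
    missed : ∃ λ w → ∀ y → ¬ g y ≈ w
    missed = notInjective⇒notSurjective g-cong (trans g0≈0 (sym g1≈0)) (1≉0 ∘ sym)
    w : Carrier
    w = proj₁ missed
    w≉0 : ¬ w ≈ 0#
    w≉0 w≈0 = proj₂ missed 0# (trans g0≈0 (sym w≈0))
    w⁻¹≉0 : ¬ w ⁻¹ ≈ 0#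
    w⁻¹≉0 w⁻¹≈0 = 1≉0 (trans (sym (x*x⁻¹≈1 w≉0)) (trans (*-congˡ w⁻¹≈0) (zeroʳ w)))
    admissible : Admissible F k (w ⁻¹)
    admissible y root = decidable-stable (y ≟ 0#) λ y≉0 → proj₂ missed y (begin
      Y * y ⁻¹                ≈⟨ *-congʳ (*-identityˡ Y) ⟨
      1# * Y * y ⁻¹           ≈⟨ *-congʳ (*-congʳ (x*x⁻¹≈1 w≉0)) ⟨
      w * w ⁻¹ * Y * y ⁻¹     ≈⟨ *-congʳ (trans (*-assoc _ _ _) (*-congˡ root)) ⟩
      w * y * y ⁻¹            ≈⟨ trans (*-assoc _ _ _) (*-congˡ (x*x⁻¹≈1 y≉0)) ⟩
      w * 1#                  ≈⟨ *-identityʳ w ⟩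
      w                       ∎)
      where
      Y : Carrier
      Y = y ^ 2 ℕ.^ k + y ^ 2

module TwistedFrobeniusShift (F : Field) (_≟_ : Decidable (Field._≈_ F)) (char2 : Characteristic2 (Field.commRing F))
                             (m : ℕ) (a : Field.Carrier F) where
  open Field F hiding (zero)
  open AG F (suc (suc m))
  open DecidableField F _≟_
  open Characteristic2Properties commRing char2
  open SemilinearMaps F _≟_ char2 (suc (suc m))
  open Exp semiring using (_^_; ^-congˡ; ^-congʳ)
  open IteratedSquares commRing
  open import Relation.Binary.Reasoning.Setoid setoid

  last : Fin (suc (suc m))
  last = fromℕ (suc m)

  Q : Point → Point
  Q d zero    = a * (d last ^ 2 + d zero ^ 2)
  Q d (suc i) = d (inject₁ i) ^ 2

  Q-semilinear : IsFrobeniusSemilinear Q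
  Q-semilinear = record { congruent = congruent ; additive = additive ; homogeneous = homogeneous }
    where
    congruent : ∀ {x y} → x ≈ᵖ y → Q x ≈ᵖ Q y
    congruent x≈y zero    = *-congˡ (+-cong (^-congˡ 2 (x≈y last)) (^-congˡ 2 (x≈y zero)))
    congruent x≈y (suc i) = ^-congˡ 2 (x≈y (inject₁ i))
    additive : ∀ x y → Q (x +ᵛ y) ≈ᵖ (Q x +ᵛ Q y)
    additive x y zero    = solve 5 (λ a xₗ yₗ x₀ y₀ → a :* ((xₗ :+ yₗ) :^ 2 :+ (x₀ :+ y₀) :^ 2)
                                   := a :* (xₗ :^ 2 :+ x₀ :^ 2) :+ a :* (yₗ :^ 2 :+ y₀ :^ 2))
                                 refl a (x last) (y last) (x zero) (y zero)
    additive x y (suc i) = solve 2 (λ u v → (u :+ v) :^ 2 := u :^ 2 :+ v :^ 2) refl (x (inject₁ i)) (y (inject₁ i))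
    homogeneous : ∀ t x → Q (t ·ᵛ x) ≈ᵖ (t ^ 2 ·ᵛ Q x)
    homogeneous t x zero    = solve 4 (λ a t xₗ x₀ → a :* ((t :* xₗ) :^ 2 :+ (t :* x₀) :^ 2)
                                      := t :^ 2 :* (a :* (xₗ :^ 2 :+ x₀ :^ 2)))
                                    refl a t (x last) (x zero)
    homogeneous t x (suc i) = solve 2 (λ t u → (t :* u) :^ 2 := t :^ 2 :* u :^ 2) refl t (x (inject₁ i))

  eigenvalue-0⇒zero : ¬ a ≈ 0# → ∀ {c d} → c ≈ 0# → Q d ≈ᵖ (c ·ᵛ d) → d ≈ᵖ 0ᵖ
  eigenvalue-0⇒zero a≉0 {d = d} c≈0 Qd≈cd =
    >-weakInduction (λ i → d i ≈ 0#) d-last≈0 (λ i _ → d-inject₁≈0 i)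
    where
    Qd≈0 : ∀ i → Q d i ≈ 0#
    Qd≈0 i = trans (Qd≈cd i) (trans (*-congʳ c≈0) (zeroˡ _))
    d-inject₁≈0 : ∀ i → d (inject₁ i) ≈ 0#
    d-inject₁≈0 i = x^2≈0⇒x≈0 (Qd≈0 (suc i))
    d-last≈0 : d last ≈ 0#
    d-last≈0 = x^2≈0⇒x≈0 (begin
      d last ^ 2   ≈⟨ x+y≈0⇒x≈y (x*y≈0⇒y≈0 a≉0 (Qd≈0 zero)) ⟩
      d zero ^ 2   ≈⟨ ^-congˡ 2 (d-inject₁≈0 zero) ⟩
      0# ^ 2       ≈⟨ zeroˡ _ ⟩
      0#           ∎)

  eigenvalue-≉0⇒zero : Admissible F (suc (suc m)) a → ∀ {c d} → ¬ c ≈ 0# → Q d ≈ᵖ (c ·ᵛ d) → d ≈ᵖ 0ᵖ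
  eigenvalue-≉0⇒zero admissible {c} {d} c≉0 Qd≈cd i = begin
    d i              ≈⟨ *-identityˡ (d i) ⟨
    1# * d i         ≈⟨ *-congʳ (x*x⁻¹≈1 c≉0) ⟨
    c * c ⁻¹ * d i   ≈⟨ *-assoc c (c ⁻¹) (d i) ⟩
    c * e i          ≈⟨ *-congˡ (e≈0 i) ⟩
    c * 0#           ≈⟨ zeroʳ c ⟩
    0#               ∎
    where
    e : Point
    e = c ⁻¹ ·ᵛ d
    e-step : ∀ i → e (suc i) ≈ e (inject₁ i) ^ 2
    e-step i = begin
      c ⁻¹ * d (suc i)                   ≈⟨ *-congˡ (x*y≈z⇒y≈x⁻¹*z c≉0 (sym (Qd≈cd (suc i)))) ⟩
      c ⁻¹ * (c ⁻¹ * d (inject₁ i) ^ 2)  ≈⟨ solve 2 (λ c′ u → c′ :* (c′ :* u :^ 2) := (c′ :* u) :^ 2)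
                                                   refl (c ⁻¹) (d (inject₁ i)) ⟩
      (c ⁻¹ * d (inject₁ i)) ^ 2         ∎
    e-root : a * (e last ^ 2 + e zero ^ 2) ≈ e zero
    e-root = begin
      a * ((c ⁻¹ * d last) ^ 2 + (c ⁻¹ * d zero) ^ 2)
        ≈⟨ solve 4 (λ a c′ dₗ d₀ → a :* ((c′ :* dₗ) :^ 2 :+ (c′ :* d₀) :^ 2)
                                 := c′ :* (c′ :* (a :* (dₗ :^ 2 :+ d₀ :^ 2))))
                 refl a (c ⁻¹) (d last) (d zero) ⟩
      c ⁻¹ * (c ⁻¹ * Q d zero) ≈⟨ *-congˡ (x*y≈z⇒y≈x⁻¹*z c≉0 (sym (Qd≈cd zero))) ⟨
      c ⁻¹ * d zero            ∎
    e-last : e last ^ 2 ≈ e zero ^ 2 ℕ.^ suc (suc m)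
    e-last = begin
      e last ^ 2                       ≈⟨ ^-congˡ 2 (squaring-chain e e-step last) ⟩
      (e zero ^ 2 ℕ.^ toℕ last) ^ 2    ≈⟨ ^-congˡ 2 (^-congʳ _ (cong (2 ℕ.^_) (toℕ-fromℕ (suc m)))) ⟩
      (e zero ^ 2 ℕ.^ suc m) ^ 2       ≈⟨ ^2^-suc (e zero) (suc m) ⟩
      e zero ^ 2 ℕ.^ suc (suc m)       ∎
    e-zero≈0 : e zero ≈ 0#
    e-zero≈0 = admissible (e zero) (trans (*-congˡ (+-congʳ (sym e-last))) e-root)
    e≈0 : e ≈ᵖ 0ᵖ
    e≈0 = <-weakInduction (λ i → e i ≈ 0#) e-zero≈0 λ i e-i≈0 →
      trans (e-step i) (trans (^-congˡ 2 e-i≈0) (zeroˡ _))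

  Q-noEigenvector : ¬ a ≈ 0# → Admissible F (suc (suc m)) a → HasNoEigenvector Q
  Q-noEigenvector a≉0 admissible d (c , Qd≈cd) with c ≟ 0#
  ... | yes c≈0 = eigenvalue-0⇒zero a≉0 c≈0 Qd≈cd
  ... | no c≉0  = eigenvalue-≉0⇒zero admissible c≉0 Qd≈cd

orthogovalPair : ∀ (F : Field) {q} → HasOrder F q → Characteristic2 (Field.commRing F) → ∀ m →
  ∃[ P ] ∃[ S ] ∃[ T ] (IsoToAG {P} S F (suc (suc m)) × IsoToAG {P} T F (suc (suc m)) × Orthogoval S T)
orthogovalPair F order char2 m =
    Points , pullback id id , pullback π π-cong
  , pullback-isoToAG id id (λ _ _ → id) (λ v → v , λ _ → refl)
  , pullback-isoToAG π π-cong π-injective π-surjective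
  , pullbacks-orthogoval π π-cong π-breaksCollinearity
  where
  open Field F
  open AG F (suc (suc m))
  open FiniteField F order using (_≟_)
  open AffineSpace F order (suc (suc m))
  admissible : ∃[ a ] (¬ a ≈ 0# × Admissible F (suc (suc m)) a)
  admissible = admissible-exists F order char2 (suc (suc m))
  open TwistedFrobeniusShift F _≟_ char2 m (proj₁ admissible) using (Q; Q-semilinear; Q-noEigenvector)
  open SemilinearMaps F _≟_ char2 (suc (suc m)) using (module Perturbation)
  open Perturbation Q-semilinear (uncurry Q-noEigenvector (proj₂ admissible))
  π-surjective : ∀ v → ∃[ x ] (π x ≈ᵖ v)
  π-surjective = Enumerated.injective⇒surjective pointEnumeration π-cong (π-injective _ _)

-- Imported only now: in the modules above, _^_ is the exponentiation of a ring.
open import Data.Nat using (_≤_; _^_; s≤s)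

mainTheorem3 : ∀ (k n : ℕ) → 2 ≤ k → 1 ≤ n → (F : Field) → HasOrder F (2 ^ n) →
    ∃[ P ] ∃[ S ] ∃[ T ] (IsoToAG {P} S F k × IsoToAG {P} T F k × Orthogoval S T)
mainTheorem3 (suc (suc m)) (suc n) (s≤s (s≤s _)) (s≤s _) F order =
  orthogovalPair F order (FiniteField.even-order⇒characteristic2 F order (m∣m*n (2 ^ n))) m
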